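{- Let $G$ be a commutative preordered group and $S$ an equivariant system of ideals for $G$. Let $L(S)$ be the union of the systems $U_{x_1}\cdots U_{x_n}(S)$ over all finite sequences $x_1,\dots,x_n$ of elements of $G$. Then $L(S)$ is the least regular equivariant system of ideals containing $S$.
   Context: $G$ is an abelian group with a preorder $\leqslant$ such that $a\leqslant b$ implies $a+c\leqslant b+c$. For nonempty finite subsets $A,B$ of $G$ write $A,B$ for $A\cup B$, $a$ for $\{a\}$, $A+x=\{a+x:a\in A\}$, $A-x=\{a-x:a\in A\}$, $A+B=\{a+b:a\in A,b\in B\}$. An equivariant system of ideals is a predicate $S$ on nonempty finite subsets of $G$ such that: (P1) $S(A)$ if $A\supseteq A'$ and $S(A')$; (P2') $S(A)$ if $S(A,u)$ and $S(A-u)$; (P3) $S(a)$ if $a\leqslant 0$ in $G$. It is regular if moreover (P2) $S(A+B)$ whenever $S(A+B,A)$ and $S(A+B,B)$, and (P5) $S(x,-x)$ for all $x\in G$. We say $S\subseteq S'$ (``$S'$ contains $S$'') if $S(A)$ implies $S'(A)$. Equivariant systems of ideals are closed under intersections. For $x\in G$, $T_x(S)$ is the least equivariant system of ideals $Q$ containing $S$ with $Q(x)$, and $U_x(S)=T_x(S)\cap T_{ -x}(S)$. The systems $U_{x_1}\cdots U_{x_n}(S)$ form a directed family. -}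

module Defs where

open import Level using (Level; suc; _⊔_)
open import Data.Product using (Σ; _×_; _,_)
open import Data.List using (List; []; _∷_; foldr)
open import Data.List.NonEmpty using (List⁺; [_]; _∷⁺_; toList; map; concatMap)
open import Data.List.Membership.Propositional using (_∈_)
open import Relation.Binary.PropositionalEquality using (_≡_)
open import Relation.Binary.Structures using (IsPreorder)
open import Algebra.Structures using (IsAbelianGroup)

record PreorderedAbelianGroup (ℓ : Level) : Set (suc ℓ) where
  infixl 6 _+_
  infix 4 _≤_
  field
    Carrier        : Set ℓ
    _+_            : Carrier → Carrier → Carrier
    0#             : Carrier
    -_             : Carrier → Carrier
    _≤_            : Carrier → Carrier → Set ℓ
    isAbelianGroup : IsAbelianGroup _≡_ _+_ 0# -_
    isPreorder     : IsPreorder _≡_ _≤_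
    compatible     : ∀ {a b} c → a ≤ b → a + c ≤ b + c

module _ {ℓ : Level} (G : PreorderedAbelianGroup ℓ) where
  open PreorderedAbelianGroup G

  -- nonempty finite subsets of G, represented by nonempty lists
  -- (predicates are compared via membership, see _⊇_ and (P1))
  FSet : Set ℓ
  FSet = List⁺ Carrier

  Pred : Set (suc ℓ)
  Pred = FSet → Set ℓ

  _⊇_ : FSet → FSet → Set ℓ
  A ⊇ A' = ∀ a → a ∈ toList A' → a ∈ toList A

  _,,_ : FSet → Carrier → FSet
  A ,, u = u ∷⁺ A

  _∪_ : FSet → FSet → FSet
  A ∪ B = Data.List.NonEmpty._⁺++⁺_ A B

  _⊖_ : FSet → Carrier → FSet
  A ⊖ x = map (λ a → a + (- x)) A

  _⊕_ : FSet → FSet → FSet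
  A ⊕ B = concatMap (λ a → map (λ b → a + b) B) A

  _⊑_ : Pred → Pred → Set ℓ
  S ⊑ S' = ∀ A → S A → S' A

  record IsEquivariantSystem (S : Pred) : Set ℓ where
    field
      P1  : ∀ A A' → A ⊇ A' → S A' → S A
      P2' : ∀ A u → S (A ,, u) → S (A ⊖ u) → S A
      P3  : ∀ a → a ≤ 0# → S [ a ]

  record IsRegular (S : Pred) : Set ℓ where
    field
      isEquivariantSystem : IsEquivariantSystem S
      P2 : ∀ A B → S ((A ⊕ B) ∪ A) → S ((A ⊕ B) ∪ B) → S (A ⊕ B)
      P5 : ∀ x → S (x ∷⁺ [ - x ])

  -- T_x(S): the least equivariant system of ideals containing S with Q(x),
  -- given as the inductive closure of S ∪ {{x}} under (P1), (P2'), (P3).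
  data T (x : Carrier) (S : Pred) : Pred where
    base : ∀ {A} → S A → T x S A
    gen  : T x S [ x ]
    p1   : ∀ {A A'} → A ⊇ A' → T x S A' → T x S A
    p2'  : ∀ {A u} → T x S (A ,, u) → T x S (A ⊖ u) → T x S A
    p3   : ∀ {a} → a ≤ 0# → T x S [ a ]

  U : Carrier → Pred → Pred
  U x S A = T x S A × T (- x) S A

  Us : List Carrier → Pred → Pred
  Us xs S = foldr U S xs

  L : Pred → Pred
  L S A = Σ (List Carrier) (λ xs → Us xs S A)

  record IsLeastRegularContaining (R S : Pred) : Set (suc ℓ) where
    field
      regular  : IsRegular R
      contains : S ⊑ R
      least    : ∀ (R' : Pred) → IsRegular R' → S ⊑ R' → R ⊑ R'

module Submission where

-- For an equivariant P, the extension T_x(P) has an explicit description by shifts: T_x(P)(A)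
-- holds iff P(A ∪ (A - x) ∪ ⋯ ∪ (A - n x)) for some n, because each new layer of elements
-- a - x can be cut away again using a - (a - x) = x.
--
-- Leastness: a regular R can cut by a whole translate, R(A ∪ (A - b)) and R(A, b) give R(A)
-- (P2 with B = {b}), and P5 supplies {x, -x}; so R absorbs shifts by x and by -x, and by
-- induction contains every U_{x₁} ⋯ U_{xₙ}(S).
--
-- Regularity: L(S) is equivariant as the union of a directed family, and U_x contains {x, -x}.
-- For P2 at A + B adjoin the U_b for b ∈ B.  Once every -b is available, (A + B) ∪ A cuts down
-- to A and then (A + B) ∪ B cuts down to A + B.  The T_b half of U_b only needs the one point b,
-- and each T_{-b} is removed again through its shift description.

open import Level using (Level)
open import Algebra.Bundles using (AbelianGroup)
open import Algebra.Structures using (IsAbelianGroup)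
open import Data.Nat using (ℕ; zero; suc; z≤n; s≤s) renaming (_+_ to _+ℕ_; _≤_ to _≤ℕ_)
open import Data.Nat.Properties using (≤-trans; m≤n⇒m≤1+n; m≤n+m; +-mono-≤)
open import Data.Product using (∃₂; ∃-syntax; _×_; _,_)
open import Data.Sum using (_⊎_; inj₁; inj₂; [_,_]′)
open import Function using (id; _∘_)
open import Data.List as List using (List; []; _∷_; _++_; applyUpTo; cartesianProductWith)
open import Data.List.NonEmpty as List⁺ using ([_]; _∷⁺_; _⁺++_; toList; head; tail)
open import Data.List.Membership.Propositional using (_∈_)
open import Data.List.Membership.Propositional.Properties
  using (∈-++⁺ˡ; ∈-++⁺ʳ; ∈-++⁻; ∈-map⁺; ∈-map⁻; ∈-applyUpTo⁺; ∈-applyUpTo⁻;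
         ∈-cartesianProductWith⁺; ∈-cartesianProductWith⁻)
open import Data.List.Relation.Unary.Any using (here; there)
open import Relation.Binary.PropositionalEquality using (_≡_; refl; sym; trans; cong; subst; module ≡-Reasoning)
open import Relation.Binary.Structures using (IsPreorder)
open import Defs as D hiding (FSet; _⊇_; _,,_; _∪_; _⊖_; _⊕_; _⊑_; T; U; Us)

module Construction {ℓ : Level} (G : PreorderedAbelianGroup ℓ) where
  open PreorderedAbelianGroup G
  open IsAbelianGroup isAbelianGroup using (_-_; assoc; inverseʳ; identityˡ)

  infix  3 _⊇_ _⊑_ _∈⁺_
  infixr 4 _∪_
  infixl 5 _,,_ _⊖_ _⊕_

  private
    FSet : Set ℓ
    FSet = D.FSet G

    _⊇_ : FSet → FSet → Set ℓ
    _⊇_ = D._⊇_ G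

    _,,_ : FSet → Carrier → FSet
    _,,_ = D._,,_ G

    _∪_ _⊕_ : FSet → FSet → FSet
    _∪_ = D._∪_ G
    _⊕_ = D._⊕_ G

    _⊖_ : FSet → Carrier → FSet
    _⊖_ = D._⊖_ G

    _⊑_ : Pred G → Pred G → Set ℓ
    _⊑_ = D._⊑_ G

    T U : Carrier → Pred G → Pred G
    T = D.T G
    U = D.U G

    Us : List Carrier → Pred G → Pred G
    Us = D.Us G

    IsEquivariant : Pred G → Set ℓ
    IsEquivariant = IsEquivariantSystem G

    +-abelianGroup : AbelianGroup ℓ ℓ
    +-abelianGroup = record
      { Carrier = Carrier ; _≈_ = _≡_ ; _∙_ = _+_ ; ε = 0# ; _⁻¹ = -_ ; isAbelianGroup = isAbelianGroup }

  open import Algebra.Properties.AbelianGroup +-abelianGroup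
    using (//-rightDividesˡ; //-rightDividesʳ; \\-leftDividesʳ; ⁻¹-involutive; ⁻¹-anti-homo‿-; ⁻¹-∙-comm; xyx⁻¹≈y)
  open import Algebra.Properties.CommutativeSemigroup (AbelianGroup.commutativeSemigroup +-abelianGroup)
    using (xy∙z≈xz∙y)
  open ≡-Reasoning

  x-[x+y]≡-y : ∀ x y → x - (x + y) ≡ - y
  x-[x+y]≡-y x y = begin
    x - (x + y)    ≡⟨ cong (x +_) (⁻¹-∙-comm x y) ⟨
    x + (- x - y)  ≡⟨ assoc x (- x) (- y) ⟨
    x - x - y      ≡⟨ cong (_- y) (inverseʳ x) ⟩
    0# - y         ≡⟨ identityˡ (- y) ⟩
    - y            ∎

  x-[x-y]≡y : ∀ x y → x - (x - y) ≡ y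
  x-[x-y]≡y x y = trans (x-[x+y]≡-y x (- y)) (⁻¹-involutive y)

  [x-z]-[y-z]≡x-y : ∀ x y z → (x - z) - (y - z) ≡ x - y
  [x-z]-[y-z]≡x-y x y z = begin
    (x - z) - (y - z)    ≡⟨ cong (x - z +_) (⁻¹-anti-homo‿- y z) ⟩
    (x - z) + (z - y)    ≡⟨ assoc x (- z) (z - y) ⟩
    x + (- z + (z - y))  ≡⟨ cong (x +_) (\\-leftDividesʳ z (- y)) ⟩
    x - y                ∎

  infixl 7 _-[_]_
  _-[_]_ : Carrier → ℕ → Carrier → Carrier
  a -[ zero ]  y = a
  a -[ suc k ] y = a -[ k ] y - y

  -[]-translate : ∀ y k a w → (a + w) -[ k ] y ≡ a -[ k ] y + w
  -[]-translate y zero    a w = refl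
  -[]-translate y (suc k) a w = trans (cong (_- y) (-[]-translate y k a w)) (xy∙z≈xz∙y _ w (- y))

  -[]-+ : ∀ y k j a → a -[ k +ℕ j ] y ≡ (a -[ j ] y) -[ k ] y
  -[]-+ y zero    j a = refl
  -[]-+ y (suc k) j a = cong (_- y) (-[]-+ y k j a)

  -[]-difference : ∀ y j a u → a -[ j ] y - u -[ j ] y ≡ a - u
  -[]-difference y zero    a u = refl
  -[]-difference y (suc j) a u = trans ([x-z]-[y-z]≡x-y _ _ y) (-[]-difference y j a u)

  -[]-shifted-difference : ∀ y k j a u → a -[ k +ℕ j ] y - u -[ j ] y ≡ (a - u) -[ k ] y
  -[]-shifted-difference y k j a u = begin
    a -[ k +ℕ j ] y - u -[ j ] y        ≡⟨ cong (λ z → z - u -[ j ] y) (-[]-+ y k j a) ⟩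
    (a -[ j ] y) -[ k ] y - u -[ j ] y  ≡⟨ -[]-translate y k (a -[ j ] y) (- (u -[ j ] y)) ⟨
    (a -[ j ] y - u -[ j ] y) -[ k ] y  ≡⟨ cong (_-[ k ] y) (-[]-difference y j a u) ⟩
    (a - u) -[ k ] y                    ∎

  _∈⁺_ : Carrier → FSet → Set ℓ
  a ∈⁺ A = a ∈ toList A

  ∈-∪⁺ˡ : ∀ {a A} B → a ∈⁺ A → a ∈⁺ A ∪ B
  ∈-∪⁺ˡ B = ∈-++⁺ˡ

  ∈-∪⁺ʳ : ∀ {a} A {B} → a ∈⁺ B → a ∈⁺ A ∪ B
  ∈-∪⁺ʳ A = ∈-++⁺ʳ (toList A)

  ∈-∪⁻ : ∀ {a} A {B} → a ∈⁺ A ∪ B → a ∈⁺ A ⊎ a ∈⁺ B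
  ∈-∪⁻ A = ∈-++⁻ (toList A)

  ∈-⁺++⁺ˡ : ∀ {a A} ys → a ∈⁺ A → a ∈⁺ A ⁺++ ys
  ∈-⁺++⁺ˡ ys = ∈-++⁺ˡ

  ∈-⁺++⁺ʳ : ∀ {a} A {ys} → a ∈ ys → a ∈⁺ A ⁺++ ys
  ∈-⁺++⁺ʳ A = ∈-++⁺ʳ (toList A)

  ∈-⁺++⁻ : ∀ {a} A {ys} → a ∈⁺ A ⁺++ ys → a ∈⁺ A ⊎ a ∈ ys
  ∈-⁺++⁻ A = ∈-++⁻ (toList A)

  ∈-⊖⁺ : ∀ {a A} x → a ∈⁺ A → a - x ∈⁺ A ⊖ x
  ∈-⊖⁺ x = ∈-map⁺ (_- x)

  ∈-⊖⁻ : ∀ {e} A x → e ∈⁺ A ⊖ x → ∃[ a ] a ∈⁺ A × e ≡ a - x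
  ∈-⊖⁻ A x = ∈-map⁻ (_- x)

  toList-⊕ : ∀ A B → toList (A ⊕ B) ≡ cartesianProductWith _+_ (toList A) (toList B)
  toList-⊕ A B = cong (List.map (head A +_) (toList B) ++_) (concat-tail (tail A))
    where
    concat-tail : ∀ as → List.concat (List.map toList (List.map (λ a → List⁺.map (a +_) B) as))
                       ≡ cartesianProductWith _+_ as (toList B)
    concat-tail []       = refl
    concat-tail (a ∷ as) = cong (List.map (a +_) (toList B) ++_) (concat-tail as)

  ∈-⊕⁺ : ∀ {a b} A B → a ∈⁺ A → b ∈⁺ B → a + b ∈⁺ A ⊕ B
  ∈-⊕⁺ {a} {b} A B a∈A b∈B = subst (a + b ∈_) (sym (toList-⊕ A B)) (∈-cartesianProductWith⁺ _+_ a∈A b∈B)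

  ∈-⊕⁻ : ∀ {e} A B → e ∈⁺ A ⊕ B → ∃₂ λ a b → a ∈⁺ A × b ∈⁺ B × e ≡ a + b
  ∈-⊕⁻ {e} A B e∈A⊕B =
    ∈-cartesianProductWith⁻ _+_ (toList A) (toList B) (subst (e ∈_) (toList-⊕ A B) e∈A⊕B)

  ⊇-[] : ∀ {a A} → a ∈⁺ A → A ⊇ [ a ]
  ⊇-[] a∈A _ (here refl) = a∈A

  ,,-mono : ∀ {A A'} u → A ⊇ A' → A ,, u ⊇ A' ,, u
  ,,-mono u A⊇A' _ (here refl)  = here refl
  ,,-mono u A⊇A' a (there a∈A') = there (A⊇A' a a∈A')

  ∪-mono : ∀ {A A' B B'} → A ⊇ A' → B ⊇ B' → A ∪ B ⊇ A' ∪ B'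
  ∪-mono {A' = A'} A⊇A' B⊇B' e e∈ with ∈-∪⁻ A' e∈
  ... | inj₁ e∈A' = ∈-∪⁺ˡ _ (A⊇A' e e∈A')
  ... | inj₂ e∈B' = ∈-∪⁺ʳ _ (B⊇B' e e∈B')

  ∪-comm-⊇ : ∀ A B → B ∪ A ⊇ A ∪ B
  ∪-comm-⊇ A B e e∈ with ∈-∪⁻ A e∈
  ... | inj₁ e∈A = ∈-∪⁺ʳ B e∈A
  ... | inj₂ e∈B = ∈-∪⁺ˡ A e∈B

  ⊖-mono : ∀ {A A'} x → A ⊇ A' → A ⊖ x ⊇ A' ⊖ x
  ⊖-mono {A' = A'} x A⊇A' e e∈A'-x with ∈-⊖⁻ A' x e∈A'-x
  ... | a , a∈A' , refl = ∈-⊖⁺ x (A⊇A' a a∈A')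

  shift : Carrier → ℕ → FSet → FSet
  shift y zero    A = A
  shift y (suc n) A = shift y n A ∪ shift y n A ⊖ y

  ∈-shift⁺ : ∀ y {n k a A} → a ∈⁺ A → k ≤ℕ n → a -[ k ] y ∈⁺ shift y n A
  ∈-shift⁺ y {zero}          a∈A z≤n       = a∈A
  ∈-shift⁺ y {suc n} {zero}  a∈A z≤n       = ∈-∪⁺ˡ _ (∈-shift⁺ y {n} a∈A z≤n)
  ∈-shift⁺ y {suc n} {suc k} a∈A (s≤s k≤n) = ∈-∪⁺ʳ (shift y n _) (∈-⊖⁺ y (∈-shift⁺ y a∈A k≤n))

  ∈-shift⁻ : ∀ y n {e} A → e ∈⁺ shift y n A → ∃₂ λ a k → a ∈⁺ A × k ≤ℕ n × e ≡ a -[ k ] y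
  ∈-shift⁻ y zero    A e∈A = _ , zero , e∈A , z≤n , refl
  ∈-shift⁻ y (suc n) A e∈ with ∈-∪⁻ (shift y n A) e∈
  ... | inj₁ e∈shift with ∈-shift⁻ y n A e∈shift
  ...   | a , k , a∈A , k≤n , e≡ = a , k , a∈A , m≤n⇒m≤1+n k≤n , e≡
  ∈-shift⁻ y (suc n) A e∈ | inj₂ e∈shift-y with ∈-⊖⁻ (shift y n A) y e∈shift-y
  ...   | e' , e'∈shift , refl with ∈-shift⁻ y n A e'∈shift
  ...     | a , k , a∈A , k≤n , refl = a , suc k , a∈A , s≤s k≤n , refl

  shift-⊇ : ∀ y n A → shift y n A ⊇ A
  shift-⊇ y n A _ a∈A = ∈-shift⁺ y {n} a∈A z≤n

  shift-mono : ∀ y n {A A'} → A ⊇ A' → shift y n A ⊇ shift y n A'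
  shift-mono y zero    A⊇A' = A⊇A'
  shift-mono y (suc n) A⊇A' = ∪-mono (shift-mono y n A⊇A') (⊖-mono y (shift-mono y n A⊇A'))

  module _ {P : Pred G} (E : IsEquivariant P) where
    open IsEquivariantSystem E

    weaken : ∀ {A A'} → A ⊇ A' → P A' → P A
    weaken = P1 _ _

    cutAll : ∀ C (X : List Carrier) → (∀ y → y ∈ X → P (C ⊖ y)) → P (C ⁺++ X) → P C
    cutAll C []      _     p = weaken (λ _ e∈C++[] → [ id , (λ ()) ]′ (∈-⁺++⁻ C e∈C++[])) p
    cutAll C (y ∷ X) P[C-y] p = cutAll C X (λ y' → P[C-y] y' ∘ there) (P2' _ y p₁ p₂)
      where
      C+X,y⊇C+y∷X : (C ⁺++ X) ,, y ⊇ C ⁺++ (y ∷ X)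
      C+X,y⊇C+y∷X e e∈ with ∈-⁺++⁻ C e∈
      ... | inj₁ e∈C         = there (∈-⁺++⁺ˡ X e∈C)
      ... | inj₂ (here refl) = here refl
      ... | inj₂ (there e∈X) = there (∈-⁺++⁺ʳ C e∈X)
      p₁ : P ((C ⁺++ X) ,, y)
      p₁ = weaken C+X,y⊇C+y∷X p
      p₂ : P ((C ⁺++ X) ⊖ y)
      p₂ = weaken (⊖-mono y (λ _ → ∈-⁺++⁺ˡ X)) (P[C-y] y (here refl))

    unshift : ∀ {x} n {A} → P [ x ] → P (shift x n A) → P A
    unshift         zero    _    p = p
    unshift {x} (suc n) {A} P[x] p = unshift n P[x] (cutAll C (toList (C ⊖ x)) removable p)
      where
      C : FSet
      C = shift x n A
      removable : ∀ y → y ∈⁺ C ⊖ x → P (C ⊖ y)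
      removable y y∈ with ∈-⊖⁻ C x y∈
      ... | c , c∈C , refl = weaken (⊇-[] (subst (_∈⁺ C ⊖ c - x) (x-[x-y]≡y c x) (∈-⊖⁺ _ c∈C))) P[x]

    shift-cut : ∀ {x A u} n₁ n₂ → P (shift x n₁ (A ,, u)) → P (shift x n₂ (A ⊖ u)) → P (shift x (n₂ +ℕ n₁) A)
    shift-cut {x} {A} {u} n₁ n₂ h₁ h₂ = cutAll (shift x N A) orbit removable (weaken covers h₁)
      where
      N : ℕ
      N = n₂ +ℕ n₁
      orbit : List Carrier
      orbit = applyUpTo (λ j → u -[ j ] x) (suc n₁)
      covers : shift x N A ⁺++ orbit ⊇ shift x n₁ (A ,, u)
      covers e e∈ with ∈-shift⁻ x n₁ _ e∈
      ... | a , k , here refl , k≤n₁ , refl = ∈-⁺++⁺ʳ (shift x N A) (∈-applyUpTo⁺ (λ j → u -[ j ] x) (s≤s k≤n₁))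
      ... | a , k , there a∈A , k≤n₁ , refl = ∈-⁺++⁺ˡ orbit (∈-shift⁺ x a∈A (≤-trans k≤n₁ (m≤n+m n₁ n₂)))
      removable : ∀ y → y ∈ orbit → P (shift x N A ⊖ y)
      removable y y∈ with ∈-applyUpTo⁻ (λ j → u -[ j ] x) y∈
      ... | j , s≤s j≤n₁ , refl = weaken contains h₂
        where
        contains : shift x N A ⊖ u -[ j ] x ⊇ shift x n₂ (A ⊖ u)
        contains e e∈ with ∈-shift⁻ x n₂ _ e∈
        ... | a' , k , a'∈A-u , k≤n₂ , refl with ∈-⊖⁻ A u a'∈A-u
        ...   | a , a∈A , refl = subst (_∈⁺ shift x N A ⊖ u -[ j ] x) (-[]-shifted-difference x k j a u)
                                   (∈-⊖⁺ _ (∈-shift⁺ x a∈A (+-mono-≤ k≤n₂ j≤n₁)))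

    T⇒shift : ∀ {x A} → T x P A → ∃[ n ] P (shift x n A)
    T⇒shift (base p) = 0 , p
    T⇒shift {x} gen =
      1 , weaken (⊇-[] (there (here refl))) (P3 (x - x) (IsPreorder.reflexive isPreorder (inverseʳ x)))
    T⇒shift {x} (p1 A⊇A' t) with T⇒shift t
    ... | n , p = n , weaken (shift-mono x n A⊇A') p
    T⇒shift (p2' t₁ t₂) with T⇒shift t₁ | T⇒shift t₂
    ... | n₁ , p₁ | n₂ , p₂ = n₂ +ℕ n₁ , shift-cut n₁ n₂ p₁ p₂
    T⇒shift (p3 a≤0) = 0 , P3 _ a≤0

  module _ {P : Pred G} (E : IsEquivariant P) (A B : FSet) where

    P2-from-point : ∀ {b} → b ∈⁺ B → P [ b ] → P (A ⊕ B ∪ A) → P (A ⊕ B)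
    P2-from-point {b} b∈B P[b] = cutAll E (A ⊕ B) (toList A) removable
      where
      removable : ∀ y → y ∈⁺ A → P (A ⊕ B ⊖ y)
      removable y y∈A =
        weaken E (⊇-[] (subst (_∈⁺ A ⊕ B ⊖ y) (xyx⁻¹≈y y b) (∈-⊖⁺ y (∈-⊕⁺ A B y∈A b∈B)))) P[b]

    P2-from-negations : (∀ {b} → b ∈⁺ B → P [ - b ]) → P (A ⊕ B ∪ A) → P (A ⊕ B ∪ B) → P (A ⊕ B)
    P2-from-negations P[-b] h₁ h₂ = cutAll E (A ⊕ B) (toList B) removableB h₂
      where
      removableA : ∀ c → c ∈⁺ A ⊕ B → P (A ⊖ c)
      removableA c c∈A⊕B with ∈-⊕⁻ A B c∈A⊕B
      ... | a , b , a∈A , b∈B , refl =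
        weaken E (⊇-[] (subst (_∈⁺ A ⊖ a + b) (x-[x+y]≡-y a b) (∈-⊖⁺ _ a∈A))) (P[-b] b∈B)
      P[A] : P A
      P[A] = cutAll E A (toList (A ⊕ B)) removableA (weaken E (∪-comm-⊇ (A ⊕ B) A) h₁)
      removableB : ∀ y → y ∈⁺ B → P (A ⊕ B ⊖ y)
      removableB y y∈B =
        weaken E (λ a a∈A → subst (_∈⁺ A ⊕ B ⊖ y) (//-rightDividesʳ y a) (∈-⊖⁺ y (∈-⊕⁺ A B a∈A y∈B))) P[A]

  T-isEquivariant : ∀ x Q → IsEquivariant (T x Q)
  T-isEquivariant x Q = record { P1 = λ _ _ → p1 ; P2' = λ _ _ → p2' ; P3 = λ _ → p3 }

  shift⇒T : ∀ {x Q} n {A} → T x Q (shift x n A) → T x Q A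
  shift⇒T n = unshift (T-isEquivariant _ _) n gen

  T-mono : ∀ {x Q Q'} → Q ⊑ Q' → T x Q ⊑ T x Q'
  T-mono Q⊑Q' _ (base q)    = base (Q⊑Q' _ q)
  T-mono Q⊑Q' _ gen         = gen
  T-mono Q⊑Q' _ (p1 s t)    = p1 s (T-mono Q⊑Q' _ t)
  T-mono Q⊑Q' _ (p2' t₁ t₂) = p2' (T-mono Q⊑Q' _ t₁) (T-mono Q⊑Q' _ t₂)
  T-mono Q⊑Q' _ (p3 a≤0)    = p3 a≤0

  U-isEquivariant : ∀ x Q → IsEquivariant (U x Q)
  U-isEquivariant x Q = record
    { P1  = λ _ _ A⊇A' (t , t') → p1 A⊇A' t , p1 A⊇A' t'
    ; P2' = λ _ _ (t₁ , t₁') (t₂ , t₂') → p2' t₁ t₂ , p2' t₁' t₂'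
    ; P3  = λ _ a≤0 → p3 a≤0 , p3 a≤0
    }

  Us-isEquivariant : ∀ {S} → IsEquivariant S → ∀ xs → IsEquivariant (Us xs S)
  Us-isEquivariant E []       = E
  Us-isEquivariant E (x ∷ xs) = U-isEquivariant x _

  Us-mono : ∀ xs {Q Q'} → Q ⊑ Q' → Us xs Q ⊑ Us xs Q'
  Us-mono []       Q⊑Q' = Q⊑Q'
  Us-mono (x ∷ xs) Q⊑Q' A (t , t') = T-mono (Us-mono xs Q⊑Q') A t , T-mono (Us-mono xs Q⊑Q') A t'

  Us-extensive : ∀ xs {Q} → Q ⊑ Us xs Q
  Us-extensive []       _ q = q
  Us-extensive (x ∷ xs) A q = base (Us-extensive xs A q) , base (Us-extensive xs A q)

  Us-++ : ∀ xs ys {Q} → Us (xs ++ ys) Q ≡ Us xs (Us ys Q)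
  Us-++ []       ys = refl
  Us-++ (x ∷ xs) ys = cong (U x) (Us-++ xs ys)

  Us-⊑-++ˡ : ∀ xs ys {Q} → Us xs Q ⊑ Us (xs ++ ys) Q
  Us-⊑-++ˡ xs ys A p = subst (λ R → R A) (sym (Us-++ xs ys)) (Us-mono xs (Us-extensive ys) A p)

  Us-⊑-++ʳ : ∀ xs ys {Q} → Us ys Q ⊑ Us (xs ++ ys) Q
  Us-⊑-++ʳ xs ys A p = subst (λ R → R A) (sym (Us-++ xs ys)) (Us-extensive xs A p)

  Ts : List Carrier → Pred G → Pred G
  Ts ys Q = List.foldr T Q ys

  Ts-isEquivariant : ∀ {Q} → IsEquivariant Q → ∀ ys → IsEquivariant (Ts ys Q)
  Ts-isEquivariant E []       = E
  Ts-isEquivariant E (y ∷ ys) = T-isEquivariant y _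

  Ts-extensive : ∀ ys {Q} → Q ⊑ Ts ys Q
  Ts-extensive []       _ q = q
  Ts-extensive (y ∷ ys) A q = base (Ts-extensive ys A q)

  Ts-gen : ∀ {y ys Q} → y ∈ ys → Ts ys Q [ y ]
  Ts-gen (here refl)  = gen
  Ts-gen (there y∈ys) = base (Ts-gen y∈ys)

  module _ {Q : Pred G} (E : IsEquivariant Q) {A B : FSet} where

    Ts-neg⇒Us : Q (A ⊕ B ∪ A) → ∀ bs → (∀ {b} → b ∈ bs → b ∈⁺ B) →
                ∀ {D} → D ⊇ A ⊕ B → Ts (List.map -_ bs) Q D → Us bs Q D
    Ts-neg⇒Us _ []       _    _      q = q
    Ts-neg⇒Us h (b ∷ bs) bs⊆B {D} D⊇A⊕B t = t⁺ , t⁻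
      where
      t⁺ : T b (Us bs Q) D
      t⁺ = p1 D⊇A⊕B (P2-from-point (T-isEquivariant b _) A B (bs⊆B (here refl)) gen (base (Us-extensive bs _ h)))
      t⁻ : T (- b) (Us bs Q) D
      t⁻ with T⇒shift (Ts-isEquivariant E (List.map -_ bs)) t
      ... | n , q = shift⇒T n (base (Ts-neg⇒Us h bs (bs⊆B ∘ there) (λ e → shift-⊇ (- b) n D e ∘ D⊇A⊕B e) q))

    Us-P2 : Q (A ⊕ B ∪ A) → Q (A ⊕ B ∪ B) → Us (toList B) Q (A ⊕ B)
    Us-P2 h₁ h₂ = Ts-neg⇒Us h₁ (toList B) id (λ _ → id)
      (P2-from-negations (Ts-isEquivariant E -B) A B (Ts-gen ∘ ∈-map⁺ (-_)) (Ts-extensive -B _ h₁) (Ts-extensive -B _ h₂))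
      where
      -B : List Carrier
      -B = List.map -_ (toList B)

  module _ {R : Pred G} (reg : IsRegular G R) where
    open IsRegular reg using (P2; P5) renaming (isEquivariantSystem to E)

    regular-cut : ∀ {A} b → R (A ∪ A ⊖ b) → R (A ,, b) → R A
    regular-cut {A} b h₁ h₂ =
      weaken E A⊇C (P2 (A ⊖ b) [ b ] (weaken E (∪-mono C⊇A (λ _ → id)) h₁) (weaken E C∪b⊇A,b h₂))
      where
      C : FSet
      C = A ⊖ b ⊕ [ b ]
      C⊇A : C ⊇ A
      C⊇A a a∈A = subst (_∈⁺ C) (//-rightDividesˡ b a) (∈-⊕⁺ (A ⊖ b) [ b ] (∈-⊖⁺ b a∈A) (here refl))
      A⊇C : A ⊇ C
      A⊇C e e∈C with ∈-⊕⁻ (A ⊖ b) [ b ] e∈C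
      ... | a' , _ , a'∈A-b , here refl , refl with ∈-⊖⁻ A b a'∈A-b
      ...   | a , a∈A , refl = subst (_∈⁺ A) (sym (//-rightDividesˡ b a)) a∈A
      C∪b⊇A,b : C ∪ [ b ] ⊇ A ,, b
      C∪b⊇A,b _ (here refl) = ∈-∪⁺ʳ C (here refl)
      C∪b⊇A,b a (there a∈A) = ∈-∪⁺ˡ [ b ] (C⊇A a a∈A)

    regular-grow : ∀ {D} x → R ((D ∪ D ⊖ - x) ,, x) → R (D ,, x)
    regular-grow {D} x h = regular-cut (- x) (weaken E grown h) (weaken E ±x (P5 x))
      where
      grown : D ,, x ∪ D ,, x ⊖ - x ⊇ (D ∪ D ⊖ - x) ,, x
      grown _ (here refl) = ∈-∪⁺ˡ {A = D ,, x} _ (here refl)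
      grown e (there e∈)  = ∪-mono (λ _ → there) (⊖-mono (- x) (λ _ → there)) e e∈
      ±x : D ,, x ,, - x ⊇ x ∷⁺ [ - x ]
      ±x _ (here refl)         = there (here refl)
      ±x _ (there (here refl)) = here refl

    regular-unshift : ∀ {x} n {D} → R (shift x n D) → R (D ,, x) → R D
    regular-unshift         zero    p _      = p
    regular-unshift {x} (suc n) {D} p R[D,x] =
      regular-unshift n (regular-cut x p (weaken E (,,-mono x (shift-⊇ x n D)) R[D,x])) R[D,x]

    regular-unshift⁻ : ∀ {x} m {D} → R (shift (- x) m D ,, x) → R (D ,, x)
    regular-unshift⁻     zero    p = p
    regular-unshift⁻ {x} (suc m) p = regular-unshift⁻ m (regular-grow x p)

    regular-unshift± : ∀ {x} n m {D} → R (shift x n D) → R (shift (- x) m D) → R D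
    regular-unshift± n m p q = regular-unshift n p (regular-unshift⁻ m (weaken E (λ _ → there) q))

  Us⊑regular : ∀ {S R} → IsEquivariant S → IsRegular G R → S ⊑ R → ∀ xs → Us xs S ⊑ R
  Us⊑regular E reg S⊑R []       = S⊑R
  Us⊑regular E reg S⊑R (x ∷ xs) A (t , t')
    with T⇒shift (Us-isEquivariant E xs) t | T⇒shift (Us-isEquivariant E xs) t'
  ... | n , p | m , q = regular-unshift± reg n m (Us⊑regular E reg S⊑R xs _ p) (Us⊑regular E reg S⊑R xs _ q)

  module _ {S : Pred G} (E : IsEquivariant S) where

    L-isEquivariant : IsEquivariant (L G S)
    L-isEquivariant = record
      { P1  = λ A A' A⊇A' (xs , p) → xs , IsEquivariantSystem.P1 (Us-isEquivariant E xs) A A' A⊇A' p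
      ; P2' = λ A u (xs , p) (ys , q) → xs ++ ys ,
                IsEquivariantSystem.P2' (Us-isEquivariant E (xs ++ ys)) A u (Us-⊑-++ˡ xs ys _ p) (Us-⊑-++ʳ xs ys _ q)
      ; P3  = λ a a≤0 → [] , IsEquivariantSystem.P3 E a a≤0
      }

    L-P2 : ∀ A B → L G S (A ⊕ B ∪ A) → L G S (A ⊕ B ∪ B) → L G S (A ⊕ B)
    L-P2 A B (xs , p) (ys , q) = toList B ++ xs ++ ys ,
      subst (λ R → R (A ⊕ B)) (sym (Us-++ (toList B) (xs ++ ys)))
        (Us-P2 (Us-isEquivariant E (xs ++ ys)) (Us-⊑-++ˡ xs ys _ p) (Us-⊑-++ʳ xs ys _ q))

    L-P5 : ∀ x → L G S (x ∷⁺ [ - x ])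
    L-P5 x = x ∷ [] , p1 (⊇-[] (here refl)) gen , p1 (⊇-[] (there (here refl))) gen

    L-isRegular : IsRegular G (L G S)
    L-isRegular = record { isEquivariantSystem = L-isEquivariant ; P2 = L-P2 ; P5 = L-P5 }

theorem4p5 : ∀ {ℓ} (G : PreorderedAbelianGroup ℓ) (S : Pred G) →
    IsEquivariantSystem G S → IsLeastRegularContaining G (L G S) S
theorem4p5 G S E = record
  { regular  = L-isRegular E
  ; contains = λ _ s → [] , s
  ; least    = λ R reg S⊑R A (xs , p) → Us⊑regular E reg S⊑R xs A p
  }
  where open Construction G
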